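{- Consider an instance of the time-based container relocation problem (CRP) with first-come-first-served retrieval order, as described in the context, that admits at least one feasible sequence of moves, and consider the objective of minimizing the total number of relocation moves. Then there exists an optimal (i.e. relocation-minimizing) feasible sequence of moves $M^*$ with the following property: for every time step $t$, if at time $t$ there is a container $c_n$ still in the bay with $d_n \le t$ (i.e. a container that is ready to be retrieved), then time step $t$ is not idle in $M^*$.
   Context: Time-based CRP: a bay has $C$ columns and $P$ tiers; slot $[i,j]$ denotes column $i$ and tier $j$, tiers indexed from the bottom ($j=1$) to the top ($j=P$). A configuration places containers in slots so that each slot holds at most one container and there is no empty slot below an occupied slot in the same column. Initially $N$ containers $c_1,\dots,c_N$ are in the bay. Time is discretized into time steps $t=1,2,\dots,T$. At each time step at most one move is performed: either a relocation (moving a container from one slot to another slot) or a retrieval (removing a container from the bay), such that the configuration stays valid after every move (so only a topmost container of a column can be moved, and a relocated container is placed on top of a column with fewer than $P$ containers). A time step in which no move is performed is called idle. Container $c_n$ has a departure time $d_n$ (a positive integer: the time step at which its external truck arrives) and an allowed delay $\delta_n\ge 0$; $c_n$ must be retrieved exactly once, at some time step $t$ with $d_n \le t \le d_n+\delta_n$; the horizon is $T=\max_n (d_n+\delta_n)$. The departure times satisfy $d_1<d_2<\dots<d_N$, and retrievals follow the first-come-first-served order: at most $n-1$ retrievals are performed before the retrieval of $c_n$ (so the containers are retrieved in the order $c_1,\dots,c_N$). A sequence of moves satisfying all these requirements is feasible; its number of relocations is the number of relocation moves it contains. -}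

module Defs where

open import Data.Nat using (ℕ; zero; suc; _+_; _≤_; _<_; _⊔_)
open import Data.Fin using (Fin; toℕ; _≟_)
open import Data.List using (List; []; _∷_; length; concat; tabulate; foldr; foldl; take; lookup; drop)
open import Data.List.Membership.Propositional using (_∈_)
open import Data.Unit using (⊤)
open import Data.Bool using (Bool; true; false; if_then_else_)
open import Data.Product using (Σ; ∃; _×_; _,_)
open import Relation.Nullary using (¬_)
open import Relation.Nullary.Decidable using (⌊_⌋)
open import Relation.Binary.PropositionalEquality using (_≡_)

-- A bay configuration with C columns holding containers from {c_0,…,c_{N-1}}
-- (container c_n of the paper is  Fin index n-1).  Each column is a stack,
-- listed from the TOP (head) to the bottom tier.  The list representation
-- encodes "no empty slot below an occupied slot"; the tier bound P is a
-- separate condition (length ≤ P).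
Config : ℕ → ℕ → Set
Config N C = Fin C → List (Fin N)

flatten : ∀ {N C} → Config N C → List (Fin N)
flatten s = concat (tabulate s)

InBay : ∀ {N C} → Fin N → Config N C → Set
InBay {C = C} c s = Σ (Fin C) λ i → c ∈ s i

Empty : ∀ {N C} → Config N C → Set
Empty {C = C} s = (i : Fin C) → s i ≡ []

data Move (C : ℕ) : Set where
  idle  : Move C
  reloc : Fin C → Fin C → Move C
  retr  : Fin C → Move C

set : ∀ {N C} → Config N C → Fin C → List (Fin N) → Config N C
set s i l j = if ⌊ j ≟ i ⌋ then l else s j

-- effect of a move (total; on invalid moves it is irrelevant since
-- feasibility rules them out)
step : ∀ {N C} → Config N C → Move C → Config N C
step s idle = s
step s (reloc i j) with s i
... | [] = s
... | c ∷ rest = let s' = set s i rest in set s' j (c ∷ s' j)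
step s (retr i) = set s i (drop 1 (s i))

configAfter : ∀ {N C} → Config N C → List (Move C) → ℕ → Config N C
configAfter s ms k = foldl step s (take k ms)

isRetr : ∀ {C} → Move C → Bool
isRetr (retr _) = true
isRetr _ = false

isReloc : ∀ {C} → Move C → Bool
isReloc (reloc _ _) = true
isReloc _ = false

countB : ∀ {A : Set} → (A → Bool) → List A → ℕ
countB p [] = 0
countB p (x ∷ xs) = if p x then suc (countB p xs) else countB p xs

retrievalsBefore : ∀ {C} → List (Move C) → ℕ → ℕ
retrievalsBefore ms k = countB isRetr (take k ms)

relocations : ∀ {C} → List (Move C) → ℕ
relocations ms = countB isReloc ms

horizon : ∀ {N} → (Fin N → ℕ) → (Fin N → ℕ) → ℕ
horizon d δ = foldr _⊔_ 0 (tabulate (λ n → d n + δ n))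

ValidMove : ∀ {N C} (P : ℕ) (d δ : Fin N → ℕ) →
            Config N C → (r t : ℕ) → Move C → Set
ValidMove P d δ s r t idle = ⊤
ValidMove P d δ s r t (reloc i j) =
  ¬ (i ≡ j) × (∃ λ c → ∃ λ rest → s i ≡ c ∷ rest) × length (s j) < P
ValidMove P d δ s r t (retr i) =
  ∃ λ c → ∃ λ rest → s i ≡ c ∷ rest
    × d c ≤ t × t ≤ d c + δ c
    × r ≤ toℕ c   -- at most n-1 retrievals before c_n (c = c_n, toℕ c = n-1)

-- A feasible sequence of moves: the k-th entry (0-based) is the move of time
-- step t = k+1; there are exactly T time steps; each move is valid in the
-- current configuration; all containers have been retrieved at the end
-- (each exactly once, since a retrieved container leaves the bay).
Feasible : ∀ {N C} (P : ℕ) (init : Config N C) (d δ : Fin N → ℕ) →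
           List (Move C) → Set
Feasible P init d δ ms =
  length ms ≡ horizon d δ
  × ((k : Fin (length ms)) →
       ValidMove P d δ (configAfter init ms (toℕ k))
                 (retrievalsBefore ms (toℕ k)) (suc (toℕ k)) (lookup ms k))
  × Empty (configAfter init ms (length ms))

Optimal : ∀ {N C} (P : ℕ) (init : Config N C) (d δ : Fin N → ℕ) →
          List (Move C) → Set
Optimal P init d δ ms =
  Feasible P init d δ ms
  × (∀ ms' → Feasible P init d δ ms' → relocations ms ≤ relocations ms')

NoIdleWhenReady : ∀ {N C} → Config N C → (Fin N → ℕ) → List (Move C) → Set
NoIdleWhenReady {N} init d ms =
  (k : Fin (length ms)) (c : Fin N) →
  InBay c (configAfter init ms (toℕ k)) → d c ≤ suc (toℕ k) →
  ¬ (lookup ms k ≡ idle)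

-- Among the relocation-minimal feasible schedules pick one that also minimises
-- the weight  Σ_{t idle} (number of steps after t);  both minima exist because
-- schedules are lists of fixed length T over a finite set of moves and
-- feasibility is decidable.  Suppose this schedule idles at a step t while a
-- container c with d c ≤ t is in the bay; skipping a run of idle steps, we may
-- assume that the move after t is not idle.  It can then be performed at t
-- instead: a relocation does not depend on time, and under FCFS a retrieval
-- takes the container of smallest index still in the bay, whose departure time
-- is at most d c ≤ t.  The swap keeps feasibility and the number of
-- relocations but lowers the weight by one.
module Submission where

open import Defs
open import Data.Nat using (ℕ; zero; suc; _+_; _≤_; _<_; _≤?_; _<?_)
import Data.Nat as ℕ
open import Data.Nat.Properties
  using (≤-refl; ≤-trans; <-trans; n<1+n; n≤1+n; +-suc; +-identityʳ; <⇒≤; <⇒≱; ≤-reflexive;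
         <-irrefl; m≤n⇒m<n∨m≡n; +-cancelˡ-≤; ≤-totalOrder)
open import Data.Fin using (Fin; toℕ; fromℕ<) renaming (_≟_ to _≟ᶠ_)
import Data.Fin as Fin
open import Data.Fin.Properties using (toℕ-injective; toℕ-fromℕ<; toℕ<n; all?)
open import Data.List
  using (List; []; _∷_; [_]; _++_; map; length; allFin; tabulate; drop; take; lookup; filter;
         cartesianProductWith)
open import Data.List.Membership.Propositional using (_∈_)
open import Data.List.Membership.Propositional.Properties
  using (∈-cartesianProductWith⁺; ∈-filter⁺; ∈-map⁺; ∈-++⁺ˡ; ∈-++⁺ʳ; ∈-concat⁻′; ∈-tabulate⁻;
         ∈-allFin)
open import Data.List.Relation.Unary.Any using (here; there)
import Data.List.Relation.Unary.All as All
open import Data.List.Relation.Unary.All.Properties using (all-filter)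
open import Data.List.Relation.Binary.Permutation.Propositional using (_↭_; ↭-sym)
open import Data.List.Relation.Binary.Permutation.Propositional.Properties using (∈-resp-↭)
import Data.List.Extrema ≤-totalOrder as Extrema
open import Data.Product using (∃; _×_; _,_; proj₁; proj₂)
open import Data.Sum using (inj₁; inj₂)
open import Data.Unit using (tt)
open import Data.Empty using (⊥-elim)
open import Data.Bool using (if_then_else_)
open import Function using (_∘_; _⇔_; mk⇔; Equivalence)
open import Relation.Nullary using (¬_; Dec; yes; no; contradiction)
open import Relation.Nullary.Decidable using (_×-dec_; ¬?; map′)
open import Relation.Unary using (Decidable)
open import Relation.Binary.PropositionalEquality
  using (_≡_; _≢_; _≗_; refl; sym; trans; cong; subst; subst₂)

private
  variable
    N C : ℕ

module _ {A : Set} {Q : A → Set} (Q? : Decidable Q)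
         (enum : List A) (enum-complete : ∀ {x} → Q x → x ∈ enum) (f : A → ℕ) where

  minimiser : ∀ {x} → Q x → ∃ λ y → Q y × (∀ z → Q z → f y ≤ f z)
  minimiser {x} qx =
    Extrema.argmin f x candidates ,
    Extrema.argmin-all f qx (all-filter Q? enum) ,
    λ z qz → All.lookup (Extrema.f[argmin]≤f[xs] x candidates)
                        (∈-filter⁺ Q? (enum-complete qz) qz)
    where candidates = filter Q? enum

listsOfLength : {A : Set} → List A → ℕ → List (List A)
listsOfLength xs zero    = [ [] ]
listsOfLength xs (suc n) = cartesianProductWith _∷_ xs (listsOfLength xs n)

∈-listsOfLength : {A : Set} {xs : List A} → (∀ x → x ∈ xs) →
                  ∀ ys → ys ∈ listsOfLength xs (length ys)
∈-listsOfLength ∈xs []       = here refl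
∈-listsOfLength ∈xs (y ∷ ys) = ∈-cartesianProductWith⁺ _∷_ (∈xs y) (∈-listsOfLength ∈xs ys)

allMoves : ∀ C → List (Move C)
allMoves C = idle ∷ map retr (allFin C) ++ cartesianProductWith reloc (allFin C) (allFin C)

∈-allMoves : (m : Move C) → m ∈ allMoves C
∈-allMoves idle        = here refl
∈-allMoves (retr i)    = there (∈-++⁺ˡ (∈-map⁺ retr (∈-allFin i)))
∈-allMoves (reloc i j) =
  there (∈-++⁺ʳ _ (∈-cartesianProductWith⁺ reloc (∈-allFin i) (∈-allFin j)))

set-≡ : (s : Config N C) (i : Fin C) (l : List (Fin N)) → set s i l i ≡ l
set-≡ s i l with i ≟ᶠ i
... | yes _  = refl
... | no i≢i = contradiction refl i≢i

set-≢ : (s : Config N C) {i j : Fin C} (l : List (Fin N)) → j ≢ i → set s i l j ≡ s j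
set-≢ s {i} {j} l j≢i with j ≟ᶠ i
... | yes j≡i = contradiction j≡i j≢i
... | no _    = refl

InBay-resp-≗ : {s s′ : Config N C} {x : Fin N} → s ≗ s′ → InBay x s → InBay x s′
InBay-resp-≗ s≗s′ (k , x∈) = k , subst (_ ∈_) (s≗s′ k) x∈

Empty⇒¬InBay : {s : Config N C} {x : Fin N} → Empty s → ¬ InBay x s
Empty⇒¬InBay empty (k , x∈) with subst (_ ∈_) (empty k) x∈
... | ()

step-reloc : (s : Config N C) {i j : Fin C} {c : Fin N} {rest : List (Fin N)} →
             s i ≡ c ∷ rest →
             step s (reloc i j) ≗ set (set s i rest) j (c ∷ set s i rest j)
step-reloc s eq k rewrite eq = refl

relocate-keeps : {s : Config N C} {i j : Fin C} {c x : Fin N} {rest : List (Fin N)} →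
                 i ≢ j → s i ≡ c ∷ rest → InBay x s → InBay x (step s (reloc i j))
relocate-keeps {s = s} {i} {j} {c} {x} {rest} i≢j eq (k , x∈) =
  InBay-resp-≗ (sym ∘ step-reloc s eq) (moved k x∈)
  where
  s′ = set s i rest
  moved : ∀ k → x ∈ s k → InBay x (set s′ j (c ∷ s′ j))
  moved k x∈ with k ≟ᶠ i | k ≟ᶠ j
  moved k x∈ | yes refl | _ with subst (x ∈_) eq x∈
  ... | here x≡c     = j , subst (x ∈_) (sym (set-≡ s′ j _)) (here x≡c)
  ... | there x∈rest = k , subst (x ∈_) (sym (trans (set-≢ s′ _ i≢j) (set-≡ s k rest))) x∈rest
  moved k x∈ | no k≢i | yes refl =
    k , subst (x ∈_) (sym (trans (set-≡ s′ k _) (cong (c ∷_) (set-≢ s rest k≢i)))) (there x∈)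
  moved k x∈ | no k≢i | no k≢j =
    k , subst (x ∈_) (sym (trans (set-≢ s′ _ k≢j) (set-≢ s rest k≢i))) x∈

retrieve-keeps : {s : Config N C} {i : Fin C} {c x : Fin N} {rest : List (Fin N)} →
                 s i ≡ c ∷ rest → x ≢ c → InBay x s → InBay x (step s (retr i))
retrieve-keeps {s = s} {i} {c} {x} eq x≢c (k , x∈) with k ≟ᶠ i
... | no k≢i = k , subst (x ∈_) (sym (set-≢ s _ k≢i)) x∈
... | yes refl with subst (x ∈_) eq x∈
...   | here x≡c     = contradiction x≡c x≢c
...   | there x∈rest = k , subst (x ∈_) (sym (trans (set-≡ s k _) (cong (drop 1) eq))) x∈rest

retrievalsAfter : Move C → ℕ → ℕ
retrievalsAfter m r = if isRetr m then suc r else r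

+-retrievals : (m : Move C) (ms : List (Move C)) (r : ℕ) →
               r + countB isRetr (m ∷ ms) ≡ retrievalsAfter m r + countB isRetr ms
+-retrievals idle        ms r = refl
+-retrievals (reloc _ _) ms r = refl
+-retrievals (retr _)    ms r = +-suc r _

relocations-∷ : (m : Move C) {xs ys : List (Move C)} →
                relocations xs ≡ relocations ys → relocations (m ∷ xs) ≡ relocations (m ∷ ys)
relocations-∷ idle        eq = eq
relocations-∷ (reloc _ _) eq = cong suc eq
relocations-∷ (retr _)    eq = eq

idleWeight : List (Move C) → ℕ
idleWeight []          = 0
idleWeight (idle ∷ ms) = length ms + idleWeight ms
idleWeight (_ ∷ ms)    = idleWeight ms

idleWeight-swap : (m : Move C) (ms : List (Move C)) → m ≢ idle →
                  idleWeight (m ∷ idle ∷ ms) < idleWeight (idle ∷ m ∷ ms)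
idleWeight-swap idle        ms m≢idle = contradiction refl m≢idle
idleWeight-swap (reloc _ _) ms _      = n<1+n _
idleWeight-swap (retr _)    ms _      = n<1+n _

idleWeight-∷-cancelˡ : (m : Move C) {xs ys : List (Move C)} → length xs ≡ length ys →
                       idleWeight (m ∷ xs) ≤ idleWeight (m ∷ ys) → idleWeight xs ≤ idleWeight ys
idleWeight-∷-cancelˡ idle {xs} {ys} eq le =
  +-cancelˡ-≤ (length xs) _ _ (subst (λ n → length xs + idleWeight xs ≤ n + idleWeight ys) (sym eq) le)
idleWeight-∷-cancelˡ (reloc _ _) eq le = le
idleWeight-∷-cancelˡ (retr _)    eq le = le

strictMono⇒mono : (f : Fin N → ℕ) → (∀ m n → m Fin.< n → f m < f n) →
                  ∀ m n → toℕ m ≤ toℕ n → f m ≤ f n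
strictMono⇒mono f mono m n m≤n with m≤n⇒m<n∨m≡n m≤n
... | inj₁ m<n = <⇒≤ (mono m n m<n)
... | inj₂ m≡n = ≤-reflexive (cong f (toℕ-injective m≡n))

module Schedules (P : ℕ) (d δ : Fin N → ℕ) where

  FeasibleFrom : Config N C → (r t : ℕ) → List (Move C) → Set
  FeasibleFrom s r t []       = Empty s
  FeasibleFrom s r t (m ∷ ms) =
    ValidMove P d δ s r t m × FeasibleFrom (step s m) (retrievalsAfter m r) (suc t) ms

  ValidThroughout : Config N C → (r t : ℕ) → List (Move C) → Set
  ValidThroughout s r t ms = (k : Fin (length ms)) →
    ValidMove P d δ (configAfter s ms (toℕ k)) (r + retrievalsBefore ms (toℕ k)) (t + toℕ k)
              (lookup ms k)

  ValidThroughout-∷ : ∀ {s : Config N C} {r t m ms} →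
    ValidThroughout s r t (m ∷ ms) ⇔
    (ValidMove P d δ s r t m × ValidThroughout (step s m) (retrievalsAfter m r) (suc t) ms)
  ValidThroughout-∷ {s = s} {r} {t} {m} {ms} = mk⇔
    (λ v → subst₂ (λ r′ t′ → ValidMove P d δ s r′ t′ m) (+-identityʳ r) (+-identityʳ t) (v Fin.zero) ,
           λ k → subst₂ (Later k) (+-retrievals m (take (toℕ k) ms) r) (+-suc t (toℕ k)) (v (Fin.suc k)))
    (λ { (v , vs) Fin.zero →
           subst₂ (λ r′ t′ → ValidMove P d δ s r′ t′ m) (sym (+-identityʳ r)) (sym (+-identityʳ t)) v
       ; (v , vs) (Fin.suc k) →
           subst₂ (Later k) (sym (+-retrievals m (take (toℕ k) ms) r)) (sym (+-suc t (toℕ k))) (vs k) })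
    where
    Later : Fin (length ms) → ℕ → ℕ → Set
    Later k r′ t′ = ValidMove P d δ (configAfter (step s m) ms (toℕ k)) r′ t′ (lookup ms k)

  FeasibleFrom⇔ : ∀ ms {s : Config N C} {r t} →
    FeasibleFrom s r t ms ⇔ (ValidThroughout s r t ms × Empty (configAfter s ms (length ms)))
  FeasibleFrom⇔ [] = mk⇔ (λ empty → (λ ()) , empty) proj₂
  FeasibleFrom⇔ (m ∷ ms) = mk⇔
    (λ (v , f) → let (vs , empty) = Equivalence.to (FeasibleFrom⇔ ms) f
                 in Equivalence.from ValidThroughout-∷ (v , vs) , empty)
    (λ (vs , empty) → let (v , vs′) = Equivalence.to ValidThroughout-∷ vs
                      in v , Equivalence.from (FeasibleFrom⇔ ms) (vs′ , empty))

  Feasible⇔ : ∀ {init : Config N C} {ms} →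
    Feasible P init d δ ms ⇔ (length ms ≡ horizon d δ × FeasibleFrom init 0 1 ms)
  Feasible⇔ {ms = ms} = mk⇔
    (λ (len , valid) → len , Equivalence.from (FeasibleFrom⇔ ms) valid)
    (λ (len , f) → len , Equivalence.to (FeasibleFrom⇔ ms) f)

  validMove? : ∀ (s : Config N C) r t m → Dec (ValidMove P d δ s r t m)
  validMove? s r t idle        = yes tt
  validMove? s r t (reloc i j) = ¬? (i ≟ᶠ j) ×-dec (nonEmpty? (s i) ×-dec (length (s j) <? P))
    where
    nonEmpty? : (l : List (Fin N)) → Dec (∃ λ c → ∃ λ rest → l ≡ c ∷ rest)
    nonEmpty? []         = no λ ()
    nonEmpty? (c ∷ rest) = yes (c , rest , refl)
  validMove? s r t (retr i) with s i
  ... | []         = no λ ()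
  ... | c ∷ rest   = map′ (λ p → c , rest , refl , p) (λ { (_ , _ , refl , p) → p })
                          (d c ≤? t ×-dec (t ≤? d c + δ c ×-dec r ≤? toℕ c))

  feasibleFrom? : ∀ ms (s : Config N C) r t → Dec (FeasibleFrom s r t ms)
  feasibleFrom? []       s r t = all? (λ i → empty? (s i))
    where
    empty? : (l : List (Fin N)) → Dec (l ≡ [])
    empty? []      = yes refl
    empty? (_ ∷ _) = no λ ()
  feasibleFrom? (m ∷ ms) s r t =
    validMove? s r t m ×-dec feasibleFrom? ms (step s m) (retrievalsAfter m r) (suc t)

  feasible? : (init : Config N C) → Decidable (Feasible P init d δ)
  feasible? init ms =
    map′ (Equivalence.from Feasible⇔) (Equivalence.to Feasible⇔)
         (length ms ℕ.≟ horizon d δ ×-dec feasibleFrom? ms init 0 1)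

  retrievals≤index : ∀ ms {s : Config N C} {r t x} →
                     FeasibleFrom s r t ms → InBay x s → r ≤ toℕ x
  retrievals≤index [] empty x∈s = ⊥-elim (Empty⇒¬InBay empty x∈s)
  retrievals≤index (idle ∷ ms) (_ , f) x∈s = retrievals≤index ms f x∈s
  retrievals≤index (reloc i j ∷ ms) ((i≢j , (_ , _ , eq) , _) , f) x∈s =
    retrievals≤index ms f (relocate-keeps i≢j eq x∈s)
  retrievals≤index (retr i ∷ ms) {x = x} ((c , _ , eq , _ , _ , r≤c) , f) x∈s with x ≟ᶠ c
  ... | yes refl = r≤c
  ... | no x≢c   = <⇒≤ (retrievals≤index ms f (retrieve-keeps eq x≢c x∈s))

  AllPresentFrom : ℕ → Config N C → Set
  AllPresentFrom r s = ∀ x → r ≤ toℕ x → InBay x s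

  -- The container retrieved next is c_r: an earlier-indexed one is gone, a
  -- later-indexed one would leave c_r stuck in the bay forever.
  retrieved-index : ∀ ms {s : Config N C} {r t i c rest} →
    AllPresentFrom r s → s i ≡ c ∷ rest → r ≤ toℕ c →
    FeasibleFrom (step s (retr i)) (suc r) t ms → toℕ c ≡ r
  retrieved-index ms {r = r} {c = c} present eq r≤c f with m≤n⇒m<n∨m≡n r≤c
  ... | inj₂ r≡c = sym r≡c
  ... | inj₁ r<c = contradiction
    (retrievals≤index ms f (retrieve-keeps eq cᵣ≢c (present cᵣ (≤-reflexive (sym cᵣ-index)))))
    (<-irrefl (sym cᵣ-index))
    where
    r<N = <-trans r<c (toℕ<n c)
    cᵣ = fromℕ< r<N
    cᵣ-index : toℕ cᵣ ≡ r
    cᵣ-index = toℕ-fromℕ< r<N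
    cᵣ≢c : cᵣ ≢ c
    cᵣ≢c cᵣ≡c = <-irrefl (trans (sym cᵣ-index) (cong toℕ cᵣ≡c)) r<c

  allPresentFrom-init : {init : Config N C} → flatten init ↭ allFin N → AllPresentFrom 0 init
  allPresentFrom-init {init = init} perm x _
    with ∈-concat⁻′ (tabulate init) (∈-resp-↭ (↭-sym perm) (∈-allFin x))
  ... | _ , x∈column , column∈ with ∈-tabulate⁻ column∈
  ...   | i , refl = i , x∈column

  allPresentFrom-step : ∀ m {ms} {s : Config N C} {r t} →
    AllPresentFrom r s → FeasibleFrom s r t (m ∷ ms) → AllPresentFrom (retrievalsAfter m r) (step s m)
  allPresentFrom-step idle present _ = present
  allPresentFrom-step (reloc i j) present ((i≢j , (_ , _ , eq) , _) , _) x r≤x =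
    relocate-keeps i≢j eq (present x r≤x)
  allPresentFrom-step (retr i) {ms} {r = r} present ((c , _ , eq , _ , _ , r≤c) , f) x r<x =
    retrieve-keeps eq x≢c (present x (≤-trans (n≤1+n r) r<x))
    where
    x≢c : x ≢ c
    x≢c x≡c = <-irrefl (sym (trans (cong toℕ x≡c) (retrieved-index ms present eq r≤c f))) r<x

  IdleMinimal : Config N C → (r t : ℕ) → List (Move C) → Set
  IdleMinimal s r t ms = ∀ ms′ → FeasibleFrom s r t ms′ → length ms′ ≡ length ms →
    relocations ms′ ≡ relocations ms → idleWeight ms ≤ idleWeight ms′

  idleMinimal-tail : ∀ m {ms} {s : Config N C} {r t} → ValidMove P d δ s r t m →
    IdleMinimal s r t (m ∷ ms) → IdleMinimal (step s m) (retrievalsAfter m r) (suc t) ms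
  idleMinimal-tail m {ms} v minimal ms′ f len rel =
    idleWeight-∷-cancelˡ m (sym len) (minimal (m ∷ ms′) (v , f) (cong suc len) (relocations-∷ m {ms′} {ms} rel))

  idle-then-move-not-minimal : ∀ {m ms} {s : Config N C} {r t} → m ≢ idle →
    ValidMove P d δ s r t m → FeasibleFrom s r t (idle ∷ m ∷ ms) → ¬ IdleMinimal s r t (idle ∷ m ∷ ms)
  idle-then-move-not-minimal {m = m} {ms} m≢idle v (_ , _ , f) minimal =
    <⇒≱ (idleWeight-swap m ms m≢idle) (minimal (m ∷ idle ∷ ms) (v , tt , f) refl refl)

  module _ (d-mono : ∀ m n → m Fin.< n → d m < d n) where

    ready⇒¬idleMinimal : ∀ ms {s : Config N C} {r t c} →
      FeasibleFrom s r t (idle ∷ ms) → AllPresentFrom r s → InBay c s → d c ≤ t →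
      ¬ IdleMinimal s r t (idle ∷ ms)
    ready⇒¬idleMinimal [] (_ , empty) _ c∈s _ _ = Empty⇒¬InBay empty c∈s
    ready⇒¬idleMinimal (idle ∷ ms) {t = t} (_ , f) present c∈s ready minimal =
      ready⇒¬idleMinimal ms f present c∈s (≤-trans ready (n≤1+n t)) (idleMinimal-tail idle {idle ∷ ms} tt minimal)
    ready⇒¬idleMinimal (reloc _ _ ∷ ms) f@(_ , v , _) _ _ _ = idle-then-move-not-minimal (λ ()) v f
    ready⇒¬idleMinimal (retr i ∷ ms) {t = t} {c}
      f@(_ , (c′ , rest , eq , _ , due , r≤c′) , f′) present c∈s ready =
      idle-then-move-not-minimal (λ ()) (c′ , rest , eq , c′-ready , ≤-trans (n≤1+n t) due , r≤c′) f
      where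
      c′-index = retrieved-index ms present eq r≤c′ f′
      c′-ready : d c′ ≤ t
      c′-ready = ≤-trans (strictMono⇒mono d d-mono c′ c
                            (subst (_≤ toℕ c) (sym c′-index) (retrievals≤index (idle ∷ retr i ∷ ms) f c∈s)))
                         ready

    NoIdleWhenReadyFrom : Config N C → ℕ → List (Move C) → Set
    NoIdleWhenReadyFrom s t ms = (k : Fin (length ms)) (c : Fin N) →
      InBay c (configAfter s ms (toℕ k)) → d c ≤ t + toℕ k → lookup ms k ≢ idle

    idleMinimal⇒noIdleWhenReady : ∀ ms {s : Config N C} {r t} →
      FeasibleFrom s r t ms → AllPresentFrom r s → IdleMinimal s r t ms → NoIdleWhenReadyFrom s t ms
    idleMinimal⇒noIdleWhenReady (m ∷ ms) {t = t} f present minimal Fin.zero c c∈s ready refl =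
      ready⇒¬idleMinimal ms f present c∈s (subst (d c ≤_) (+-identityʳ t) ready) minimal
    idleMinimal⇒noIdleWhenReady (m ∷ ms) {t = t} f@(v , f′) present minimal (Fin.suc k) c c∈s ready =
      idleMinimal⇒noIdleWhenReady ms f′ (allPresentFrom-step m present f) (idleMinimal-tail m v minimal)
        k c c∈s (subst (d c ≤_) (+-suc t (toℕ k)) ready)

  schedules : ∀ C → List (List (Move C))
  schedules C = listsOfLength (allMoves C) (horizon d δ)

  Feasible⇒∈schedules : ∀ {init : Config N C} {ms} → Feasible P init d δ ms → ms ∈ schedules C
  Feasible⇒∈schedules {C = C} {ms = ms} (len , _) =
    subst (λ n → ms ∈ listsOfLength (allMoves C) n) len (∈-listsOfLength ∈-allMoves ms)

  optimal-idleMinimal : (init : Config N C) → ∃ (Feasible P init d δ) →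
                        ∃ λ ms → Optimal P init d δ ms × IdleMinimal init 0 1 ms
  optimal-idleMinimal {C = C} init (_ , f₀)
    with minimiser (feasible? init) (schedules C) Feasible⇒∈schedules relocations f₀
  ... | ms₁ , f₁ , fewest
    with minimiser (λ ms → feasible? init ms ×-dec (relocations ms ≤? relocations ms₁))
                   (schedules C) (Feasible⇒∈schedules ∘ proj₁) idleWeight (f₁ , ≤-refl)
  ... | ms , (f , ≤ms₁) , lightest =
    ms , (f , λ ms′ f′ → ≤-trans ≤ms₁ (fewest ms′ f′)) ,
    λ ms′ f′ len rel → lightest ms′ (Equivalence.from Feasible⇔ (trans len (proj₁ f) , f′) ,
                                      ≤-trans (≤-reflexive rel) ≤ms₁)

lemma1 : (N C P : ℕ) (init : Config N C) (d δ : Fin N → ℕ) →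
    ((i : Fin C) → length (init i) ≤ P) →
    flatten init ↭ allFin N →
    ((n : Fin N) → 1 ≤ d n) →
    ((m n : Fin N) → m Data.Fin.< n → d m < d n) →
    (∃ λ ms → Feasible P init d δ ms) →
    ∃ λ ms → Optimal P init d δ ms × NoIdleWhenReady init d ms
lemma1 N C P init d δ _ perm _ d-mono feasible =
  let ms , optimal@(f , _) , minimal = optimal-idleMinimal init feasible
  in ms , optimal ,
     idleMinimal⇒noIdleWhenReady d-mono ms (proj₂ (Equivalence.to Feasible⇔ f))
                                 (allPresentFrom-init perm) minimal
  where open Schedules P d δ
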